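{- Let $G$ be a finite graph. For every path segment $w$ of $G$, $\operatorname{cdim}(G-G(w))<\operatorname{cdim}(G)$.
   Context: Graphs are finite, $G=(V,E,r)$ with $r$ assigning to each edge a set of one or two endpoints (loops and multiple edges allowed). A walk $w=(w_0,w_1,\dots,w_{2k})$ alternates vertices $w_{2i}$ and edges $w_{2i+1}$ with $r(w_{2i+1})=\{w_{2i},w_{2i+2}\}$; $k$ is its length. A cycle is a closed walk ($w_0=w_{2k}$, $k\ge1$) with no repeated edge and no repeated vertex other than $w_0=w_{2k}$. The body $G(w)$ of a walk is the subgraph consisting of its vertices and edges. $\mathrm{Cycle}(G)$ is the set of bodies of cycles of $G$, and for a vertex $v$, $\mathrm{Cycle}(v)$ is the set of members of $\mathrm{Cycle}(G)$ containing $v$. $G^c$ is the union of all members of $\mathrm{Cycle}(G)$, and $\deg_c(v)$ is the degree of $v$ in $G^c$ ($0$ if $v\notin G^c$). For a subgraph $\bar G$ of $G$, $G-\bar G$ is the subgraph whose edge set is $E\setminus \bar E$ and whose vertices are the vertices of $G$ not in $\bar G$ together with all endpoints of edges in $E\setminus\bar E$. A sign labeling of $G$ is a map $f:\mathrm{Cycle}(G)\times E\to\{ -1,0,1\}$ with $f(C,e)=0$ iff $e\notin C$; $f(C)\in\mathbb R^E$ denotes $e\mapsto f(C,e)$. The cyclic dimension is $\operatorname{cdim}(G)=\min_f \dim\operatorname{span}\{f(C):C\in\mathrm{Cycle}(G)\}$ over all sign labelings $f$. A vertex $v$ is cycle generic if $\deg_c(v)\ge3$ or there is no vertex $u$ with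 $\mathrm{Cycle}(v)\subsetneq\mathrm{Cycle}(u)$. A path segment is a walk $w=(w_0,\dots,w_{2k})$ with $k\ge1$ such that $G(w)$ is contained in some member of $\mathrm{Cycle}(G)$, $w_0$ and $w_{2k}$ are cycle generic, and none of $w_2,w_4,\dots,w_{2k-2}$ is cycle generic. -}

module Defs where

open import Data.Nat using (ℕ; zero; suc; _≤_; _<_; _+_)
open import Data.Fin using (Fin; zero; suc; inject₁; fromℕ; toℕ; _≟_)
open import Data.Fin.Subset as S using (Subset; _∈_; _∉_; _⊆_; ∁; _∪_; ⋃; ⁅_⁆)
open import Data.Product using (Σ; ∃; _×_; _,_; proj₁; proj₂)
open import Data.Sum using (_⊎_)
open import Data.Bool using (if_then_else_)
open import Data.List as List using (List)
open import Data.Vec using (lookup)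
open import Data.Rational using (ℚ; 0ℚ; 1ℚ; -_) renaming (_*_ to _*ℚ_; _+_ to _+ℚ_)
open import Relation.Binary.PropositionalEquality using (_≡_; _≢_)
open import Relation.Nullary using (¬_; does)

-- Finite graphs G = (V, E, r) with loops and multiple edges.
-- V = Fin n, E = Fin m, and r(e) = {a, b} where ends e = (a , b);
-- a loop is an edge with a ≡ b.

record Graph : Set where
  field
    n    : ℕ
    m    : ℕ
    ends : Fin m → Fin n × Fin n

open Graph public

Joins : (G : Graph) → Fin (m G) → Fin (n G) → Fin (n G) → Set
Joins G e x y = (ends G e ≡ (x , y)) ⊎ (ends G e ≡ (y , x))

-- A walk (w₀,…,w_{2k}): vertices vtx 0 … vtx k, edges edg 0 … edg (k-1),
-- edge i joins vtx i and vtx (i+1).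
record Walk (G : Graph) : Set where
  field
    len : ℕ
    vtx : Fin (suc len) → Fin (n G)
    edg : Fin len → Fin (m G)
    joins : ∀ (i : Fin len) → Joins G (edg i) (vtx (inject₁ i)) (vtx (suc i))

open Walk public

record Sub (G : Graph) : Set where
  constructor ⟨_,_⟩
  field
    vs : Subset (n G)
    es : Subset (m G)

open Sub public

full : (G : Graph) → Sub G
full G = ⟨ S.⊤ , S.⊤ ⟩

body : {G : Graph} → Walk G → Sub G
body w = ⟨ ⋃ (List.tabulate (λ i → ⁅ vtx w i ⁆))
         , ⋃ (List.tabulate (λ i → ⁅ edg w i ⁆)) ⟩

endpoints : (G : Graph) → Subset (m G) → Subset (n G)
endpoints G E = ⋃ (List.tabulate (λ e →
  if lookup E e then ⁅ proj₁ (ends G e) ⁆ ∪ ⁅ proj₂ (ends G e) ⁆ else S.⊥))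

minus : (G : Graph) → Sub G → Sub G
minus G ⟨ V̄ , Ē ⟩ = ⟨ ∁ V̄ ∪ endpoints G (∁ Ē) , ∁ Ē ⟩

IsCycle : {G : Graph} → Sub G → Walk G → Set
IsCycle H w =
  (1 ≤ len w)
  × (vtx w zero ≡ vtx w (fromℕ (len w)))
  × (∀ i j → edg w i ≡ edg w j → i ≡ j)
  × (∀ i j → vtx w (inject₁ i) ≡ vtx w (inject₁ j) → i ≡ j)
  × (∀ i → vtx w i ∈ vs H)
  × (∀ i → edg w i ∈ es H)

CycleBody : {G : Graph} → Sub G → Sub G → Set
CycleBody {G} H C = Σ (Walk G) λ w → IsCycle H w × (body w ≡ C)

InCycleOf : (G : Graph) → Fin (n G) → Sub G → Set
InCycleOf G v C = CycleBody (full G) C × (v ∈ vs C)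

CycleSSub : (G : Graph) → Fin (n G) → Fin (n G) → Set
CycleSSub G v u =
  (∀ C → InCycleOf G v C → InCycleOf G u C)
  × (∃ λ C → InCycleOf G u C × ¬ InCycleOf G v C)

IsCycEdges : (G : Graph) → Subset (m G) → Set
IsCycEdges G Ec =
  ∀ e → (e ∈ Ec → ∃ λ C → CycleBody (full G) C × e ∈ es C)
      × ((∃ λ C → CycleBody (full G) C × e ∈ es C) → e ∈ Ec)

-- number of ends of e equal to v (a loop counts twice)
mult : (G : Graph) → Fin (m G) → Fin (n G) → ℕ
mult G e v = (if does (proj₁ (ends G e) ≟ v) then 1 else 0)
           + (if does (proj₂ (ends G e) ≟ v) then 1 else 0)

sumFin : {A : Set} → (_⊕_ : A → A → A) → A → (k : ℕ) → (Fin k → A) → A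
sumFin _⊕_ z zero    f = z
sumFin _⊕_ z (suc k) f = f zero ⊕ sumFin _⊕_ z k (λ i → f (suc i))

degIn : (G : Graph) → Subset (m G) → Fin (n G) → ℕ
degIn G Es v = sumFin _+_ 0 (m G) (λ e → if lookup Es e then mult G e v else 0)

CycleGeneric : (G : Graph) → Fin (n G) → Set
CycleGeneric G v =
  (∃ λ Ec → IsCycEdges G Ec × (3 ≤ degIn G Ec v))
  ⊎ (¬ (∃ λ u → CycleSSub G v u))

IsPathSegment : (G : Graph) → Walk G → Set
IsPathSegment G w =
  (1 ≤ len w)
  × (∃ λ C → CycleBody (full G) C × (vs (body w) ⊆ vs C)
                                  × (es (body w) ⊆ es C))
  × CycleGeneric G (vtx w zero)
  × CycleGeneric G (vtx w (fromℕ (len w)))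
  × (∀ (i : Fin (suc (len w))) → 0 < toℕ i → toℕ i < len w → ¬ CycleGeneric G (vtx w i))

data Sgn : Set where
  neg zer pos : Sgn

toℚ : Sgn → ℚ
toℚ neg = - 1ℚ
toℚ zer = 0ℚ
toℚ pos = 1ℚ

-- f(C, e) for a body C (only values on members of Cycle(H) matter)
Labeling : Graph → Set
Labeling G = Sub G → Fin (m G) → Sgn

IsSignLabeling : {G : Graph} → Sub G → Labeling G → Set
IsSignLabeling H f =
  ∀ C → CycleBody H C → ∀ e → (f C e ≡ zer → e ∉ es C) × (e ∉ es C → f C e ≡ zer)

Vect : Graph → Set
Vect G = Fin (m G) → ℚ

InFamily : {G : Graph} → Sub G → Labeling G → Vect G → Set
InFamily H f v = ∃ λ C → CycleBody H C × (∀ e → v e ≡ toℚ (f C e))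

lincomb : (G : Graph) {d : ℕ} → (Fin d → ℚ) → (Fin d → Vect G) → Vect G
lincomb G {d} c b e = sumFin _+ℚ_ 0ℚ d (λ i → c i *ℚ b i e)

LinIndep : (G : Graph) {d : ℕ} → (Fin d → Vect G) → Set
LinIndep G b = ∀ c → (∀ e → lincomb G c b e ≡ 0ℚ) → ∀ i → c i ≡ 0ℚ

SpanDim : (G : Graph) → (Vect G → Set) → ℕ → Set
SpanDim G P d =
  Σ (Fin d → Vect G) λ b →
    (∀ i → P (b i)) × LinIndep G b × (∀ v → P v → ∃ λ c → ∀ e → v e ≡ lincomb G c b e)

CDim : {G : Graph} → Sub G → ℕ → Set
CDim {G} H d =
  (∃ λ f → IsSignLabeling H f × SpanDim G (InFamily H f) d)
  × (∀ f d' → IsSignLabeling H f → SpanDim G (InFamily H f) d' → d ≤ d')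

module Submission where

-- Only one feature of the path segment w is used: it has an edge e lying on a cycle C of G,
-- while G − G(w) keeps no edge of w, so no cycle of G − G(w) passes through e.  Let f be a
-- sign labeling attaining cdim G.  Restricted to the cycles of G − G(w) it is again a sign
-- labeling, all of whose vectors vanish at e, whereas f(C) does not.  So f(C) is independent
-- of them and cdim (G − G(w)) ≤ dim span < dim span f(Cycle G) = cdim G.  Dimensions are
-- compared by the Steinitz exchange lemma, proved by Gaussian elimination over ℚ; the minimum
-- defining cdim exists because the cycles, and hence the relevant sign labelings, can be
-- enumerated.

open import Defs
open import Data.Nat using (ℕ; _<_)
open import Data.Product using (∃₂; _×_)

open import Algebra.Bundles using (CommutativeRing)
open import Data.Bool using (Bool; true; false)
open import Data.Bool.Properties using () renaming (_≟_ to _≟ᵇ_)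
open import Data.Empty using (⊥-elim)
open import Data.Fin using (Fin; zero; suc; punchIn; inject₁; fromℕ; fromℕ<)
open import Data.Fin.Properties using (any?; all?; punchIn-punchOut; injective⇒≤) renaming (_≟_ to _≟ᶠ_)
open import Data.Fin.Subset using (⋃; ⁅_⁆) renaming (_∈_ to _∈ˢ_; _∉_ to _∉ˢ_)
open import Data.Fin.Subset.Properties
  using (x∈p∪q⁺; x∈p∪q⁻; x∈⁅x⁆; x∈⁅y⁆⇒x≡y; ∉⊥; ∈⊤; x∈∁p⇒x∉p) renaming (_∈?_ to _∈ˢ?_)
open import Data.List using (List; []; _∷_; [_]; map; filter; concatMap; cartesianProduct; cartesianProductWith; upTo; allFin; tabulate)
open import Data.List.Extrema.Nat using (argmin; f[argmin]≤v⁺)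
open import Data.List.Membership.Propositional using (_∈_; lose)
open import Data.List.Membership.Propositional.Properties
  using ( ∈-map⁺; ∈-map⁻; ∈-filter⁺; ∈-filter⁻; ∈-concatMap⁺; ∈-cartesianProduct⁺
        ; ∈-cartesianProductWith⁺; ∈-upTo⁺; ∈-allFin)
open import Data.List.Properties using (tabulate-cong)
open import Data.List.Relation.Unary.Any using (here; there)
open import Data.Nat using (zero; suc; _≤_; _≤?_; z≤n; s≤s)
open import Data.Nat.Properties using (m≤n⇒m≤1+n; ≤-<-trans)
open import Data.Product as Product using (∃; _,_; proj₁; proj₂)
open import Data.Product.Properties using (≡-dec)
open import Data.Rational as ℚ using (ℚ; 0ℚ; 1ℚ; -_; _*_; _+_; _-_; 1/_)
open import Data.Rational.Properties as ℚP using (_≟_)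
open import Data.Rational.Solver using (module +-*-Solver)
open import Data.Sum as Sum using (_⊎_; inj₁; inj₂)
open import Data.Vec using (Vec; []; _∷_; lookup)
import Data.Vec as Vec
import Data.Vec.Properties as Vec
open import Data.Vec.Properties using (lookup∘tabulate)
open import Data.Vec.Functional using (Vector; tail; insertAt; removeAt) renaming (_∷_ to _∷ᵥ_)
open import Data.Vec.Functional.Properties using (insertAt-lookup; insertAt-punchIn)
open import Relation.Binary.PropositionalEquality using (_≡_; _≢_; refl; sym; trans; cong; cong₂; subst; module ≡-Reasoning)
open import Relation.Nullary using (Dec; yes; no; ¬?)
open import Relation.Nullary.Decidable using (decidable-stable; _×-dec_; _⊎-dec_; _→-dec_)

open import Algebra.Properties.Semiring.Sum (CommutativeRing.semiring ℚP.+-*-commutativeRing)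
  using (sum; sum-syntax; sum-cong-≗; sum-remove; sum-replicate-zero; ∑-distrib-+; ∑-comm; *-distribˡ-sum; *-distribʳ-sum)
open +-*-Solver using (solve; _:+_; _:*_; :-_; _:-_; _:=_; con)
open ≡-Reasoning

private
  variable
    A : Set
    N k d : ℕ

lc : Vector ℚ d → Vector (Vector ℚ N) d → Vector ℚ N
lc c b e = sum (λ i → c i * b i e)

Independent : Vector (Vector ℚ N) d → Set
Independent b = ∀ c → (∀ e → lc c b e ≡ 0ℚ) → ∀ i → c i ≡ 0ℚ

Dependent : Vector (Vector ℚ N) d → Set
Dependent b = ∃ λ c → (∃ λ i → c i ≢ 0ℚ) × (∀ e → lc c b e ≡ 0ℚ)

InSpan : Vector (Vector ℚ N) d → Vector ℚ N → Set
InSpan b v = ∃ λ c → ∀ e → v e ≡ lc c b e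

sum-zero : (f : Vector ℚ k) → (∀ i → f i ≡ 0ℚ) → sum f ≡ 0ℚ
sum-zero {k} f f≡0 = trans (sum-cong-≗ f≡0) (sum-replicate-zero k)

lc-cong : (c c′ : Vector ℚ d) (b : Vector (Vector ℚ N) d) → (∀ i → c i ≡ c′ i) → ∀ e → lc c b e ≡ lc c′ b e
lc-cong c c′ b c≗c′ e = sum-cong-≗ (λ i → cong (_* b i e) (c≗c′ i))

lc-zero : (c : Vector ℚ d) (b : Vector (Vector ℚ N) d) → (∀ i → c i ≡ 0ℚ) → ∀ e → lc c b e ≡ 0ℚ
lc-zero c b c≡0 e = sum-zero _ (λ i → trans (cong (_* b i e) (c≡0 i)) (ℚP.*-zeroˡ (b i e)))

lc-lc : (c : Vector ℚ k) (M : Vector (Vector ℚ d) k) (b : Vector (Vector ℚ N) d) →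
        ∀ e → lc c (λ i → lc (M i) b) e ≡ lc (lc c M) b e
lc-lc {k} {d} c M b e = begin
  ∑[ i < k ] (c i * ∑[ j < d ] (M i j * b j e))    ≡⟨ sum-cong-≗ {k} (λ i → *-distribˡ-sum {d} (c i) _) ⟩
  ∑[ i < k ] ∑[ j < d ] (c i * (M i j * b j e))    ≡⟨ ∑-comm {k} {d} _ ⟩
  ∑[ j < d ] ∑[ i < k ] (c i * (M i j * b j e))
    ≡⟨ sum-cong-≗ {d} (λ j → sum-cong-≗ {k} (λ i → sym (ℚP.*-assoc (c i) (M i j) (b j e)))) ⟩
  ∑[ j < d ] ∑[ i < k ] (c i * M i j * b j e)      ≡⟨ sum-cong-≗ {d} (λ j → sym (*-distribʳ-sum {k} (b j e) _)) ⟩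
  ∑[ j < d ] (∑[ i < k ] (c i * M i j) * b j e)    ∎

*-cancelʳ-0 : ∀ {α} x → α ≢ 0ℚ → x * α ≡ 0ℚ → x ≡ 0ℚ
*-cancelʳ-0 {α} x α≢0 xα≡0 = begin
  x                ≡⟨ sym (ℚP.*-identityʳ x) ⟩
  x * 1ℚ           ≡⟨ cong (x *_) (sym (ℚP.*-inverseʳ α)) ⟩
  x * (α * 1/ α)   ≡⟨ sym (ℚP.*-assoc x α (1/ α)) ⟩
  x * α * 1/ α     ≡⟨ cong (_* 1/ α) xα≡0 ⟩
  0ℚ * 1/ α        ≡⟨ ℚP.*-zeroˡ (1/ α) ⟩
  0ℚ               ∎
  where instance _ = ℚ.≢-nonZero α≢0

∀-punchIn : ∀ {n} {P : Fin (suc n) → Set} (p : Fin (suc n)) → P p → (∀ j → P (punchIn p j)) → ∀ i → P i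
∀-punchIn {P = P} p Pp Pp↑ i with i ≟ᶠ p
... | yes refl = Pp
... | no i≢p = subst P (punchIn-punchOut (λ p≡i → i≢p (sym p≡i))) (Pp↑ _)

-- One step of Gaussian elimination: clear the first coordinate of every row but the pivot row a p.
module Pivot (a : Vector (Vector ℚ (suc N)) (suc k)) (p : Fin (suc k)) (α≢0 : a p zero ≢ 0ℚ) where

  α⁻¹ : ℚ
  α⁻¹ = (1/ a p zero) {{ℚ.≢-nonZero α≢0}}

  μ : Vector ℚ k
  μ j = a (punchIn p j) zero * α⁻¹

  reduced : Vector (Vector ℚ (suc N)) k
  reduced j e = a (punchIn p j) e - μ j * a p e

  reduced-head : ∀ j → reduced j zero ≡ 0ℚ
  reduced-head j = begin
    x - x * α⁻¹ * α    ≡⟨ solve 3 (λ x y z → x :- x :* y :* z := x :- x :* (z :* y)) refl x α⁻¹ α ⟩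
    x - x * (α * α⁻¹)  ≡⟨ cong (λ t → x - x * t) (ℚP.*-inverseʳ α {{ℚ.≢-nonZero α≢0}}) ⟩
    x - x * 1ℚ         ≡⟨ solve 1 (λ x → x :- x :* con 1ℚ := con 0ℚ) refl x ⟩
    0ℚ                 ∎
    where
    x = a (punchIn p j) zero
    α = a p zero

  pivotWeight : Vector ℚ (suc k) → ℚ
  pivotWeight c = ∑[ j < k ] (removeAt c p j * μ j)

  lc-decompose : ∀ c e → lc c a e ≡ (c p + pivotWeight c) * a p e + lc (removeAt c p) reduced e
  lc-decompose c e = begin
    lc c a e                                   ≡⟨ sum-remove {i = p} (λ i → c i * a i e) ⟩
    c p * y + ∑[ j < k ] (c′ j * x j)          ≡⟨ cong (c p * y +_) off-pivot ⟩
    c p * y + (lc c′ reduced e + W * y)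
      ≡⟨ solve 4 (λ cp y R W → cp :* y :+ (R :+ W :* y) := (cp :+ W) :* y :+ R) refl (c p) y (lc c′ reduced e) W ⟩
    (c p + W) * y + lc c′ reduced e            ∎
    where
    c′ = removeAt c p
    W = pivotWeight c
    y = a p e
    x : Vector ℚ k
    x j = a (punchIn p j) e
    off-pivot : ∑[ j < k ] (c′ j * x j) ≡ lc c′ reduced e + W * y
    off-pivot = begin
      ∑[ j < k ] (c′ j * x j)
        ≡⟨ sum-cong-≗ {k} (λ j → solve 4 (λ c x μ y → c :* x := c :* (x :- μ :* y) :+ c :* μ :* y) refl (c′ j) (x j) (μ j) y) ⟩
      ∑[ j < k ] (c′ j * reduced j e + c′ j * μ j * y)          ≡⟨ ∑-distrib-+ {k} _ _ ⟩
      lc c′ reduced e + ∑[ j < k ] (c′ j * μ j * y)             ≡⟨ cong (lc c′ reduced e +_) (sym (*-distribʳ-sum {k} y _)) ⟩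
      lc c′ reduced e + W * y                                   ∎

  reducedTails : Vector (Vector ℚ N) k
  reducedTails j = tail (reduced j)

  pivot-independent : Independent reducedTails → Independent a
  pivot-independent indep c lc≡0 = ∀-punchIn p cp≡0 c′≡0
    where
    c′ = removeAt c p
    W = pivotWeight c
    reduced-lc-head : lc c′ reduced zero ≡ 0ℚ
    reduced-lc-head = sum-zero _ (λ j → trans (cong (c′ j *_) (reduced-head j)) (ℚP.*-zeroʳ (c′ j)))
    cp+W≡0 : c p + W ≡ 0ℚ
    cp+W≡0 = *-cancelʳ-0 (c p + W) α≢0 (begin
      (c p + W) * a p zero                              ≡⟨ sym (ℚP.+-identityʳ _) ⟩
      (c p + W) * a p zero + 0ℚ                         ≡⟨ cong ((c p + W) * a p zero +_) (sym reduced-lc-head) ⟩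
      (c p + W) * a p zero + lc c′ reduced zero         ≡⟨ sym (lc-decompose c zero) ⟩
      lc c a zero                                       ≡⟨ lc≡0 zero ⟩
      0ℚ                                                ∎)
    c′≡0 : ∀ j → c′ j ≡ 0ℚ
    c′≡0 = indep c′ λ e → begin
      lc c′ reduced (suc e)                             ≡⟨ sym (ℚP.+-identityˡ _) ⟩
      0ℚ + lc c′ reduced (suc e)
        ≡⟨ cong (_+ lc c′ reduced (suc e)) (sym (trans (cong (_* a p (suc e)) cp+W≡0) (ℚP.*-zeroˡ (a p (suc e))))) ⟩
      (c p + W) * a p (suc e) + lc c′ reduced (suc e)   ≡⟨ sym (lc-decompose c (suc e)) ⟩
      lc c a (suc e)                                    ≡⟨ lc≡0 (suc e) ⟩
      0ℚ                                                ∎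
    cp≡0 : c p ≡ 0ℚ
    cp≡0 = begin
      c p       ≡⟨ sym (ℚP.+-identityʳ (c p)) ⟩
      c p + 0ℚ  ≡⟨ cong (c p +_) (sym (sum-zero _ (λ j → trans (cong (_* μ j) (c′≡0 j)) (ℚP.*-zeroˡ (μ j))))) ⟩
      c p + W   ≡⟨ cp+W≡0 ⟩
      0ℚ        ∎

  pivot-dependent : Dependent reducedTails → Dependent a
  pivot-dependent (d , (j₀ , dj₀≢0) , rel) = c , (punchIn p j₀ , c↑j₀≢0) , lc≡0
    where
    c = insertAt d p (- ∑[ j < k ] (d j * μ j))
    c↑≡d : ∀ j → removeAt c p j ≡ d j
    c↑≡d = insertAt-punchIn d p _
    c↑j₀≢0 : c (punchIn p j₀) ≢ 0ℚ
    c↑j₀≢0 eq = dj₀≢0 (trans (sym (c↑≡d j₀)) eq)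
    cp+W≡0 : c p + pivotWeight c ≡ 0ℚ
    cp+W≡0 = begin
      c p + pivotWeight c
        ≡⟨ cong₂ _+_ (insertAt-lookup d p _) (sum-cong-≗ {k} (λ j → cong (_* μ j) (c↑≡d j))) ⟩
      - ∑[ j < k ] (d j * μ j) + ∑[ j < k ] (d j * μ j) ≡⟨ ℚP.+-inverseˡ (∑[ j < k ] (d j * μ j)) ⟩
      0ℚ                                                ∎
    lc≡0 : ∀ e → lc c a e ≡ 0ℚ
    lc≡0 e = begin
      lc c a e                                          ≡⟨ lc-decompose c e ⟩
      (c p + pivotWeight c) * a p e + lc (removeAt c p) reduced e
        ≡⟨ cong₂ (λ s t → s * a p e + t) cp+W≡0 (lc-cong _ d reduced c↑≡d e) ⟩
      0ℚ * a p e + lc d reduced e                       ≡⟨ cong₂ _+_ (ℚP.*-zeroˡ (a p e)) (reduced-lc e) ⟩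
      0ℚ + 0ℚ                                           ≡⟨ ℚP.+-identityˡ 0ℚ ⟩
      0ℚ                                                ∎
      where
      reduced-lc : ∀ e → lc d reduced e ≡ 0ℚ
      reduced-lc zero = sum-zero _ (λ j → trans (cong (d j *_) (reduced-head j)) (ℚP.*-zeroʳ (d j)))
      reduced-lc (suc e) = rel e

independent-tail : (a : Vector (Vector ℚ (suc N)) k) → Independent (λ i → tail (a i)) → Independent a
independent-tail a indep c lc≡0 = indep c (λ e → lc≡0 (suc e))

dependent-tail : (a : Vector (Vector ℚ (suc N)) k) → (∀ i → a i zero ≡ 0ℚ) →
                 Dependent (λ i → tail (a i)) → Dependent a
dependent-tail a head≡0 (c , c≢0 , rel) = c , c≢0 , λ
  { zero    → sum-zero _ (λ i → trans (cong (c i *_) (head≡0 i)) (ℚP.*-zeroʳ (c i)))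
  ; (suc e) → rel e }

independent-or-dependent : ∀ N (a : Vector (Vector ℚ N) k) → (Independent a × k ≤ N) ⊎ Dependent a
independent-or-dependent {zero}  zero a = inj₁ ((λ _ _ ()) , z≤n)
independent-or-dependent {suc k} zero a = inj₂ ((λ _ → 1ℚ) , (zero , λ ()) , (λ ()))
independent-or-dependent (suc N) a with any? (λ i → ¬? (a i zero ≟ 0ℚ))
independent-or-dependent {suc k} (suc N) a | yes (p , α≢0) =
  Sum.map (Product.map pivot-independent s≤s) pivot-dependent (independent-or-dependent N reducedTails)
  where open Pivot a p α≢0
independent-or-dependent (suc N) a | no no-pivot =
  Sum.map (Product.map (independent-tail a) m≤n⇒m≤1+n) (dependent-tail a head≡0)
          (independent-or-dependent N (λ i → tail (a i)))
  where
  head≡0 : ∀ i → a i zero ≡ 0ℚ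
  head≡0 i = decidable-stable (a i zero ≟ 0ℚ) (λ aᵢ≢0 → no-pivot (i , aᵢ≢0))

lc-scale : ∀ x (c : Vector ℚ d) (b : Vector (Vector ℚ N) d) e → lc (λ i → x * c i) b e ≡ x * lc c b e
lc-scale {d} x c b e = begin
  ∑[ i < d ] (x * c i * b i e)    ≡⟨ sum-cong-≗ {d} (λ i → ℚP.*-assoc x (c i) (b i e)) ⟩
  ∑[ i < d ] (x * (c i * b i e))  ≡⟨ sym (*-distribˡ-sum {d} x _) ⟩
  x * lc c b e                    ∎

steinitz : (a : Vector (Vector ℚ N) k) (b : Vector (Vector ℚ N) d) →
           Independent a → (∀ i → InSpan b (a i)) → k ≤ d
steinitz {d = d} a b indep span with independent-or-dependent d (λ i → proj₁ (span i))
... | inj₁ (_ , k≤d) = k≤d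
... | inj₂ (c , (i , cᵢ≢0) , rel) = ⊥-elim (cᵢ≢0 (indep c lc≡0 i))
  where
  M = λ i → proj₁ (span i)
  lc≡0 : ∀ e → lc c a e ≡ 0ℚ
  lc≡0 e = begin
    lc c a e                     ≡⟨ sum-cong-≗ (λ i → cong (c i *_) (proj₂ (span i) e)) ⟩
    lc c (λ i → lc (M i) b) e    ≡⟨ lc-lc c M b e ⟩
    lc (lc c M) b e              ≡⟨ lc-zero (lc c M) b rel e ⟩
    0ℚ                           ∎

relation-∷-trivial : (b : Vector (Vector ℚ N) d) (u : Vector ℚ N) → Independent b →
                     (c : Vector ℚ (suc d)) → (∀ e → lc c (u ∷ᵥ b) e ≡ 0ℚ) → c zero ≡ 0ℚ → ∀ i → c i ≡ 0ℚ
relation-∷-trivial b u indep c rel c₀≡0 = ∀-punchIn {P = λ i → c i ≡ 0ℚ} zero c₀≡0 (indep (tail c) tail-rel)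
  where
  tail-rel : ∀ e → lc (tail c) b e ≡ 0ℚ
  tail-rel e = begin
    lc (tail c) b e                   ≡⟨ sym (ℚP.+-identityˡ _) ⟩
    0ℚ + lc (tail c) b e              ≡⟨ cong (_+ lc (tail c) b e) (sym (trans (cong (_* u e) c₀≡0) (ℚP.*-zeroˡ (u e)))) ⟩
    c zero * u e + lc (tail c) b e    ≡⟨ rel e ⟩
    0ℚ                                ∎

independent-∷-or-inSpan : (b : Vector (Vector ℚ N) d) (v : Vector ℚ N) →
                          Independent b → Independent (v ∷ᵥ b) ⊎ InSpan b v
independent-∷-or-inSpan {N} b v indep with independent-or-dependent N (v ∷ᵥ b)
... | inj₁ (indep′ , _) = inj₁ indep′
... | inj₂ (c , (i , cᵢ≢0) , rel) with c zero ≟ 0ℚ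
...   | yes c₀≡0 = ⊥-elim (cᵢ≢0 (relation-∷-trivial b v indep c rel c₀≡0 i))
...   | no c₀≢0 = inj₂ ((λ j → - c₀⁻¹ * c (suc j)) , v≡lc)
  where
  instance _ = ℚ.≢-nonZero c₀≢0
  c₀⁻¹ = 1/ c zero
  v≡lc : ∀ e → v e ≡ lc (λ j → - c₀⁻¹ * c (suc j)) b e
  v≡lc e = begin
    v e                                              ≡⟨ sym (ℚP.*-identityʳ (v e)) ⟩
    v e * 1ℚ                                         ≡⟨ cong (v e *_) (sym (ℚP.*-inverseʳ (c zero))) ⟩
    v e * (c zero * c₀⁻¹)
      ≡⟨ solve 4 (λ v c₀ c₀⁻¹ L → v :* (c₀ :* c₀⁻¹) := c₀⁻¹ :* (c₀ :* v :+ L) :+ (:- c₀⁻¹) :* L) refl (v e) (c zero) c₀⁻¹ L ⟩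
    c₀⁻¹ * (c zero * v e + L) + - c₀⁻¹ * L           ≡⟨ cong (λ t → c₀⁻¹ * t + - c₀⁻¹ * L) (rel e) ⟩
    c₀⁻¹ * 0ℚ + - c₀⁻¹ * L
      ≡⟨ solve 2 (λ c₀⁻¹ L → c₀⁻¹ :* con 0ℚ :+ (:- c₀⁻¹) :* L := (:- c₀⁻¹) :* L) refl c₀⁻¹ L ⟩
    - c₀⁻¹ * L                                       ≡⟨ sym (lc-scale (- c₀⁻¹) (tail c) b e) ⟩
    lc (λ j → - c₀⁻¹ * c (suc j)) b e                ∎
    where L = lc (tail c) b e

independent-∷ : (b : Vector (Vector ℚ N) d) (u : Vector ℚ N) (e : Fin N) →
                Independent b → (∀ i → b i e ≡ 0ℚ) → u e ≢ 0ℚ → Independent (u ∷ᵥ b)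
independent-∷ b u e indep bₑ≡0 uₑ≢0 c rel = relation-∷-trivial b u indep c rel c₀≡0
  where
  tail-lcₑ≡0 : lc (tail c) b e ≡ 0ℚ
  tail-lcₑ≡0 = sum-zero _ (λ i → trans (cong (c (suc i) *_) (bₑ≡0 i)) (ℚP.*-zeroʳ (c (suc i))))
  c₀≡0 : c zero ≡ 0ℚ
  c₀≡0 = *-cancelʳ-0 (c zero) uₑ≢0 (begin
    c zero * u e                       ≡⟨ sym (ℚP.+-identityʳ _) ⟩
    c zero * u e + 0ℚ                  ≡⟨ cong (c zero * u e +_) (sym tail-lcₑ≡0) ⟩
    c zero * u e + lc (tail c) b e     ≡⟨ rel e ⟩
    0ℚ                                 ∎)

InSpan-∷ : (b : Vector (Vector ℚ N) d) (u : Vector ℚ N) {v : Vector ℚ N} → InSpan b v → InSpan (u ∷ᵥ b) v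
InSpan-∷ b u {v} (c , v≡lc) = (0ℚ ∷ᵥ c) , λ e → begin
  v e                        ≡⟨ v≡lc e ⟩
  lc c b e                   ≡⟨ sym (ℚP.+-identityˡ _) ⟩
  0ℚ + lc c b e              ≡⟨ cong (_+ lc c b e) (sym (ℚP.*-zeroˡ (u e))) ⟩
  0ℚ * u e + lc c b e        ∎

InSpan-head : (b : Vector (Vector ℚ N) d) (u : Vector ℚ N) → InSpan (u ∷ᵥ b) u
InSpan-head {d = d} b u = (1ℚ ∷ᵥ λ _ → 0ℚ) , λ e → sym (begin
  1ℚ * u e + lc (λ _ → 0ℚ) b e    ≡⟨ cong₂ _+_ (ℚP.*-identityˡ (u e)) (lc-zero _ b (λ _ → refl) e) ⟩
  u e + 0ℚ                        ≡⟨ ℚP.+-identityʳ (u e) ⟩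
  u e                             ∎)

record Basis (P : Vector ℚ N → Set) (r : ℕ) : Set where
  field
    vec         : Vector (Vector ℚ N) r
    member      : ∀ i → P (vec i)
    independent : Independent vec
    spanning    : ∀ {v} → P v → InSpan vec v

basis-of-list : (vs : List (Vector ℚ N)) → ∃ (Basis (_∈ vs))
basis-of-list [] = 0 , record { vec = λ () ; member = λ () ; independent = λ _ _ () ; spanning = λ () }
basis-of-list (u ∷ vs) with basis-of-list vs
... | r , B with independent-∷-or-inSpan (Basis.vec B) u (Basis.independent B)
...   | inj₁ indep = suc r , record
  { vec         = u ∷ᵥ vec
  ; member      = λ { zero → here refl ; (suc i) → there (member i) }
  ; independent = indep
  ; spanning    = λ { (here refl) → InSpan-head vec u ; (there v∈vs) → InSpan-∷ vec u (spanning v∈vs) }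
  }
  where open Basis B
...   | inj₂ u∈span = r , record
  { vec         = vec
  ; member      = λ i → there (member i)
  ; independent = independent
  ; spanning    = λ { (here refl) → u∈span ; (there v∈vs) → spanning v∈vs }
  }
  where open Basis B

basis-exists : {P : Vector ℚ N → Set} (vs : List (Vector ℚ N)) → (∀ {u} → u ∈ vs → P u) →
               (∀ {v} → P v → ∃ λ u → u ∈ vs × (∀ e → v e ≡ u e)) → ∃ (Basis P)
basis-exists vs all-P covers with basis-of-list vs
... | r , B = r , record
  { vec         = vec
  ; member      = λ i → all-P (member i)
  ; independent = independent
  ; spanning    = λ Pv → let (u , u∈vs , v≗u) = covers Pv ; (c , u≡lc) = spanning u∈vs
                         in c , λ e → trans (v≗u e) (u≡lc e)
  }
  where open Basis B

Basis-≤ : {P Q : Vector ℚ N → Set} {r d : ℕ} → Basis P r → Basis Q d → (∀ {v} → P v → Q v) → r ≤ d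
Basis-≤ B₁ B₂ P⊆Q = steinitz (Basis.vec B₁) (Basis.vec B₂) (Basis.independent B₁)
                             (λ i → Basis.spanning B₂ (P⊆Q (Basis.member B₁ i)))

Basis-< : {P Q : Vector ℚ N → Set} {r d : ℕ} → Basis P r → Basis Q d → (∀ {v} → P v → Q v) →
          (e : Fin N) → (∀ {v} → P v → v e ≡ 0ℚ) → (u : Vector ℚ N) → Q u → u e ≢ 0ℚ → r < d
Basis-< B₁ B₂ P⊆Q e Pₑ≡0 u Qu uₑ≢0 = steinitz (u ∷ᵥ Basis.vec B₁) (Basis.vec B₂)
  (independent-∷ (Basis.vec B₁) u e (Basis.independent B₁) (λ i → Pₑ≡0 (Basis.member B₁ i)) uₑ≢0)
  (λ { zero → Basis.spanning B₂ Qu ; (suc i) → Basis.spanning B₂ (P⊆Q (Basis.member B₁ i)) })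

allVec : List A → (k : ℕ) → List (Vec A k)
allVec xs zero    = [ [] ]
allVec xs (suc k) = cartesianProductWith _∷_ xs (allVec xs k)

∈-allVec : {xs : List A} → (∀ x → x ∈ xs) → (v : Vec A k) → v ∈ allVec xs k
∈-allVec xs-all []      = here refl
∈-allVec xs-all (x ∷ v) = ∈-cartesianProductWith⁺ _∷_ (xs-all x) (∈-allVec xs-all v)

∈-⋃-singletons⁺ : ∀ {n} (f : Fin k → Fin n) i → f i ∈ˢ ⋃ (tabulate (λ j → ⁅ f j ⁆))
∈-⋃-singletons⁺ f zero    = x∈p∪q⁺ (inj₁ (x∈⁅x⁆ (f zero)))
∈-⋃-singletons⁺ f (suc i) = x∈p∪q⁺ (inj₂ (∈-⋃-singletons⁺ (λ j → f (suc j)) i))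

∈-⋃-singletons⁻ : ∀ {n} (f : Fin k → Fin n) {x} → x ∈ˢ ⋃ (tabulate (λ j → ⁅ f j ⁆)) → ∃ λ j → x ≡ f j
∈-⋃-singletons⁻ {zero}  f x∈ = ⊥-elim (∉⊥ x∈)
∈-⋃-singletons⁻ {suc k} f x∈ with x∈p∪q⁻ ⁅ f zero ⁆ _ x∈
... | inj₁ x∈f₀ = zero , x∈⁅y⁆⇒x≡y (f zero) x∈f₀
... | inj₂ x∈fs = let (j , x≡fj) = ∈-⋃-singletons⁻ (λ j → f (suc j)) x∈fs in suc j , x≡fj

module _ (G : Graph) where

  joins? : ∀ e x y → Dec (Joins G e x y)
  joins? e x y = ≡-dec _≟ᶠ_ _≟ᶠ_ (ends G e) (x , y) ⊎-dec ≡-dec _≟ᶠ_ _≟ᶠ_ (ends G e) (y , x)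

  isCycle? : (H : Sub G) (w : Walk G) → Dec (IsCycle H w)
  isCycle? H w =
    (1 ≤? len w)
    ×-dec (vtx w zero ≟ᶠ vtx w (fromℕ (len w)))
    ×-dec all? (λ i → all? (λ j → (edg w i ≟ᶠ edg w j) →-dec (i ≟ᶠ j)))
    ×-dec all? (λ i → all? (λ j → (vtx w (inject₁ i) ≟ᶠ vtx w (inject₁ j)) →-dec (i ≟ᶠ j)))
    ×-dec all? (λ i → vtx w i ∈ˢ? vs H)
    ×-dec all? (λ i → edg w i ∈ˢ? es H)

  Traversable : (vs : Vec (Fin (n G)) (suc k)) (es : Vec (Fin (m G)) k) → Set
  Traversable {k} vs es = ∀ (i : Fin k) → Joins G (lookup es i) (lookup vs (inject₁ i)) (lookup vs (suc i))

  walkAlong : (vs : Vec (Fin (n G)) (suc k)) (es : Vec (Fin (m G)) k) → Traversable vs es → Walk G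
  walkAlong {k} vs es joins = record { len = k ; vtx = lookup vs ; edg = lookup es ; joins = joins }

  walksAlong : Vec (Fin (n G)) (suc k) × Vec (Fin (m G)) k → List (Walk G)
  walksAlong (vs , es) with all? (λ i → joins? (lookup es i) (lookup vs (inject₁ i)) (lookup vs (suc i)))
  ... | yes joins = [ walkAlong vs es joins ]
  ... | no _      = []

  walks : List (Walk G)
  walks = concatMap (λ k → concatMap walksAlong
                             (cartesianProduct (allVec (allFin (n G)) (suc k)) (allVec (allFin (m G)) k)))
                    (upTo (suc (n G)))

  cycles : Sub G → List (Sub G)
  cycles H = map body (filter (isCycle? H) walks)

  cycles-sound : {H C : Sub G} → C ∈ cycles H → CycleBody H C
  cycles-sound C∈ with ∈-map⁻ body C∈
  ... | w , w∈ , refl = w , proj₂ (∈-filter⁻ (isCycle? _) {xs = walks} w∈) , refl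

  IsCycle⇒len≤n : {H : Sub G} {w : Walk G} → IsCycle H w → len w ≤ n G
  IsCycle⇒len≤n (_ , _ , _ , vtx-inj , _) = injective⇒≤ (λ {i} {j} → vtx-inj i j)

  module Retrace (w : Walk G) where

    vertices : Vec (Fin (n G)) (suc (len w))
    vertices = Vec.tabulate (vtx w)

    edges : Vec (Fin (m G)) (len w)
    edges = Vec.tabulate (edg w)

    traversable : Traversable vertices edges
    traversable i rewrite lookup∘tabulate (edg w) i | lookup∘tabulate (vtx w) (inject₁ i)
                        | lookup∘tabulate (vtx w) (suc i) = joins w i

    module _ (j : Traversable vertices edges) where

      w′ : Walk G
      w′ = walkAlong vertices edges j

      isCycle : ∀ {H} → IsCycle H w → IsCycle H w′
      isCycle {H} (1≤len , closed , edg-inj , vtx-inj , vtx∈ , edg∈) =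
          1≤len
        , trans (vtx≡ zero) (trans closed (sym (vtx≡ (fromℕ (len w)))))
        , (λ i i′ eq → edg-inj i i′ (trans (sym (edg≡ i)) (trans eq (edg≡ i′))))
        , (λ i i′ eq → vtx-inj i i′ (trans (sym (vtx≡ (inject₁ i))) (trans eq (vtx≡ (inject₁ i′)))))
        , (λ i → subst (_∈ˢ vs H) (sym (vtx≡ i)) (vtx∈ i))
        , (λ i → subst (_∈ˢ es H) (sym (edg≡ i)) (edg∈ i))
        where
        vtx≡ = lookup∘tabulate (vtx w)
        edg≡ = lookup∘tabulate (edg w)

      body≡ : body w′ ≡ body w
      body≡ = cong₂ ⟨_,_⟩ (cong ⋃ (tabulate-cong (λ i → cong ⁅_⁆ (lookup∘tabulate (vtx w) i))))
                          (cong ⋃ (tabulate-cong (λ i → cong ⁅_⁆ (lookup∘tabulate (edg w) i))))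

    ∈-walksAlong : ∃ λ j → w′ j ∈ walksAlong (vertices , edges)
    ∈-walksAlong with all? (λ i → joins? (lookup edges i) (lookup vertices (inject₁ i)) (lookup vertices (suc i)))
    ... | yes j = j , here refl
    ... | no ¬j = ⊥-elim (¬j traversable)

    ∈-walks : len w ≤ n G → ∃ λ j → w′ j ∈ walks
    ∈-walks len≤n = let (j , ∈along) = ∈-walksAlong in j ,
      ∈-concatMap⁺ _ (lose (∈-upTo⁺ (s≤s len≤n))
        (∈-concatMap⁺ walksAlong
          (lose (∈-cartesianProduct⁺ (∈-allVec (∈-allFin {n G}) vertices) (∈-allVec (∈-allFin {m G}) edges)) ∈along)))

  cycles-complete : {H C : Sub G} → CycleBody H C → C ∈ cycles H
  cycles-complete {H} (w , cyc , refl) with Retrace.∈-walks w (IsCycle⇒len≤n {H} {w} cyc)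
  ... | j , w′∈ = subst (_∈ cycles H) (body≡ j)
                        (∈-map⁺ body (∈-filter⁺ (isCycle? H) w′∈ (isCycle j cyc)))
    where open Retrace w

sumFin≡sum : (f : Vector ℚ k) → sumFin _+_ 0ℚ k f ≡ sum f
sumFin≡sum {zero}  f = refl
sumFin≡sum {suc k} f = cong (f zero +_) (sumFin≡sum (λ i → f (suc i)))

module _ (G : Graph) where

  lincomb≡lc : (c : Vector ℚ d) (b : Vector (Vect G) d) → ∀ e → lincomb G c b e ≡ lc c b e
  lincomb≡lc c b e = sumFin≡sum (λ i → c i * b i e)

  SpanDim⇒Basis : {P : Vect G → Set} → SpanDim G P d → Basis P d
  SpanDim⇒Basis (b , b∈P , indep , span) = record
    { vec         = b
    ; member      = b∈P
    ; independent = λ c lc≡0 → indep c (λ e → trans (lincomb≡lc c b e) (lc≡0 e))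
    ; spanning    = λ Pv → let (c , v≡) = span _ Pv in c , λ e → trans (v≡ e) (lincomb≡lc c b e)
    }

  Basis⇒SpanDim : {P : Vect G → Set} → Basis P d → SpanDim G P d
  Basis⇒SpanDim B =
      vec
    , member
    , (λ c lc≡0 → independent c (λ e → trans (sym (lincomb≡lc c vec e)) (lc≡0 e)))
    , (λ v Pv → let (c , v≡) = spanning Pv in c , λ e → trans (v≡ e) (sym (lincomb≡lc c vec e)))
    where open Basis B

  cycleVector : Labeling G → Sub G → Vect G
  cycleVector f C e = toℚ (f C e)

  spanDim-exists : (H : Sub G) (f : Labeling G) → ∃ (SpanDim G (InFamily H f))
  spanDim-exists H f =
    let (r , B) = basis-exists (map (cycleVector f) (cycles G H)) member covers in r , Basis⇒SpanDim B
    where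
    member : ∀ {u} → u ∈ map (cycleVector f) (cycles G H) → InFamily H f u
    member u∈ with ∈-map⁻ (cycleVector f) u∈
    ... | C , C∈ , refl = C , cycles-sound G C∈ , λ e → refl
    covers : ∀ {v} → InFamily H f v → ∃ λ u → u ∈ map (cycleVector f) (cycles G H) × (∀ e → v e ≡ u e)
    covers (C , cyc , v≡) = cycleVector f C , ∈-map⁺ (cycleVector f) (cycles-complete G cyc) , v≡

  CycleBody-full : {H C : Sub G} → CycleBody H C → CycleBody (full G) C
  CycleBody-full (w , (1≤len , closed , edg-inj , vtx-inj , _ , _) , body≡) =
    w , (1≤len , closed , edg-inj , vtx-inj , (λ _ → ∈⊤) , (λ _ → ∈⊤)) , body≡

  IsSignLabeling-restrict : {H : Sub G} {f : Labeling G} → IsSignLabeling (full G) f → IsSignLabeling H f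
  IsSignLabeling-restrict sign-f C cyc = sign-f C (CycleBody-full cyc)

  InFamily-agree : {H : Sub G} {f g : Labeling G} → (∀ {C} → CycleBody H C → ∀ e → f C e ≡ g C e) →
                   ∀ {v} → InFamily H f v → InFamily H g v
  InFamily-agree f≗g (C , cyc , v≡) = C , cyc , λ e → trans (v≡ e) (cong toℚ (f≗g cyc e))

  Signs : Set
  Signs = Vec Bool (m G)

  _≟ˢ_ : (C C′ : Sub G) → Dec (C ≡ C′)
  ⟨ V , E ⟩ ≟ˢ ⟨ V′ , E′ ⟩ with Vec.≡-dec _≟ᵇ_ V V′ | Vec.≡-dec _≟ᵇ_ E E′
  ... | yes refl | yes refl = yes refl
  ... | no V≢V′  | _        = no (λ { refl → V≢V′ refl })
  ... | yes _    | no E≢E′  = no (λ { refl → E≢E′ refl })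

  -- Bodies not listed in the table get all-positive signs, a junk default: every cycle of H is listed.
  signsOf : List (Sub G) → List Signs → Sub G → Signs
  signsOf (C′ ∷ Cs) (σ ∷ σs) C with C′ ≟ˢ C
  ... | yes _ = σ
  ... | no _  = signsOf Cs σs C
  signsOf _ _ C = Vec.replicate (m G) true

  signsOf-map : (φ : Sub G → Signs) (Cs : List (Sub G)) {C : Sub G} → C ∈ Cs → signsOf Cs (map φ Cs) C ≡ φ C
  signsOf-map φ (C′ ∷ Cs) {C} C∈ with C′ ≟ˢ C | C∈
  ... | yes refl | _          = refl
  ... | no C′≢C  | here C≡C′  = ⊥-elim (C′≢C (sym C≡C′))
  ... | no _     | there C∈Cs = signsOf-map φ Cs C∈Cs

  allSigns : List Signs
  allSigns = allVec (true ∷ false ∷ []) (m G)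

  signChoices : List (Sub G) → List (List Signs)
  signChoices []       = [ [] ]
  signChoices (_ ∷ Cs) = cartesianProductWith _∷_ allSigns (signChoices Cs)

  map-∈-signChoices : (φ : Sub G → Signs) (Cs : List (Sub G)) → map φ Cs ∈ signChoices Cs
  map-∈-signChoices φ []       = here refl
  map-∈-signChoices φ (C ∷ Cs) =
    ∈-cartesianProductWith⁺ _∷_ (∈-allVec (λ { true → here refl ; false → there (here refl) }) (φ C))
                                (map-∈-signChoices φ Cs)

  sgn : Bool → Sgn
  sgn true  = pos
  sgn false = neg

  isPos : Sgn → Bool
  isPos pos = true
  isPos _   = false

  sgn-isPos : ∀ s → s ≢ zer → sgn (isPos s) ≡ s
  sgn-isPos pos _   = refl
  sgn-isPos neg _   = refl
  sgn-isPos zer s≢0 = ⊥-elim (s≢0 refl)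

  tableLabeling : List (Sub G) → List Signs → Labeling G
  tableLabeling Cs σs C e with e ∈ˢ? es C
  ... | yes _ = sgn (lookup (signsOf Cs σs C) e)
  ... | no _  = zer

  tableLabeling-isSignLabeling : (H : Sub G) (Cs : List (Sub G)) (σs : List Signs) →
                                 IsSignLabeling H (tableLabeling Cs σs)
  tableLabeling-isSignLabeling H Cs σs C _ e with e ∈ˢ? es C
  ... | yes e∈C = (λ s≡0 → ⊥-elim (sgn≢zer _ s≡0)) , (λ e∉C → ⊥-elim (e∉C e∈C))
    where
    sgn≢zer : ∀ b → sgn b ≢ zer
    sgn≢zer true  ()
    sgn≢zer false ()
  ... | no e∉C = (λ _ → e∉C) , (λ _ → refl)

  signsOfLabeling : Labeling G → Sub G → Signs
  signsOfLabeling f C = Vec.tabulate (λ e → isPos (f C e))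

  tableLabeling-agrees : {H : Sub G} {f : Labeling G} → IsSignLabeling H f → ∀ {C} → CycleBody H C → ∀ e →
                         tableLabeling (cycles G H) (map (signsOfLabeling f) (cycles G H)) C e ≡ f C e
  tableLabeling-agrees {H} {f} sign-f {C} cyc e with e ∈ˢ? es C
  ... | no e∉C = sym (proj₂ (sign-f C cyc e) e∉C)
  ... | yes e∈C = begin
    sgn (lookup (signsOf (cycles G H) (map (signsOfLabeling f) (cycles G H)) C) e)
      ≡⟨ cong (λ σ → sgn (lookup σ e)) (signsOf-map (signsOfLabeling f) (cycles G H) (cycles-complete G cyc)) ⟩
    sgn (lookup (signsOfLabeling f C) e)   ≡⟨ cong sgn (lookup∘tabulate _ e) ⟩
    sgn (isPos (f C e))                    ≡⟨ sgn-isPos (f C e) (λ fCe≡0 → proj₁ (sign-f C cyc e) fCe≡0 e∈C) ⟩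
    f C e                                   ∎

  -- A sign labeling of H matters only through its signs on the finitely many cycles of H,
  -- so the minimum defining cdim H is a minimum over the finite list of sign tables.
  cdim-exists : (H : Sub G) → ∃ (CDim H)
  cdim-exists H = rank σ* , (tableLabeling Cs σ* , tableLabeling-isSignLabeling H Cs σ* , proj₂ (dim σ*)) , minimal
    where
    Cs = cycles G H
    dim : (σs : List Signs) → ∃ (SpanDim G (InFamily H (tableLabeling Cs σs)))
    dim σs = spanDim-exists H (tableLabeling Cs σs)
    rank : List Signs → ℕ
    rank σs = proj₁ (dim σs)
    σ* = argmin rank [] (signChoices Cs)
    minimal : ∀ f d′ → IsSignLabeling H f → SpanDim G (InFamily H f) d′ → rank σ* ≤ d′
    minimal f d′ sign-f span = f[argmin]≤v⁺ {f = rank} [] (signChoices Cs)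
      (inj₂ (lose (map-∈-signChoices (signsOfLabeling f) Cs)
                  (Basis-≤ (SpanDim⇒Basis (proj₂ (dim σf))) (SpanDim⇒Basis span)
                           (InFamily-agree (tableLabeling-agrees sign-f)))))
      where σf = map (signsOfLabeling f) Cs

  cycle-avoids-removed-edges : {B C : Sub G} → CycleBody (minus G B) C → ∀ {e} → e ∈ˢ es B → e ∉ˢ es C
  cycle-avoids-removed-edges {B} (w , (_ , _ , _ , _ , _ , edg∈) , refl) e∈B e∈C =
    let (j , e≡) = ∈-⋃-singletons⁻ (edg w) e∈C
    in x∈∁p⇒x∉p (subst (_∈ˢ es (minus G B)) (sym e≡) (edg∈ j)) e∈B

  toℚ-≢0 : ∀ s → s ≢ zer → toℚ s ≢ 0ℚ
  toℚ-≢0 pos _   ()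
  toℚ-≢0 neg _   ()
  toℚ-≢0 zer s≢0 = ⊥-elim (s≢0 refl)

  spanDim-< : {f : Labeling G} → IsSignLabeling (full G) f →
              {H C* : Sub G} → CycleBody (full G) C* → ∀ {e} → e ∈ˢ es C* → (∀ {C} → CycleBody H C → e ∉ˢ es C) →
              ∀ {r d} → SpanDim G (InFamily H f) r → SpanDim G (InFamily (full G) f) d → r < d
  spanDim-< {f} sign-f {H} {C*} cyc* {e} e∈C* avoid span₁ span₂ =
    Basis-< (SpanDim⇒Basis span₁) (SpanDim⇒Basis span₂) (λ (C , cyc , v≡) → C , CycleBody-full cyc , v≡)
            e vanishes (cycleVector f C*) (C* , cyc* , λ _ → refl)
            (toℚ-≢0 (f C* e) (λ fC*e≡0 → proj₁ (sign-f C* cyc* e) fC*e≡0 e∈C*))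
    where
    vanishes : ∀ {v} → InFamily H f v → v e ≡ 0ℚ
    vanishes (C , cyc , v≡) = trans (v≡ e) (cong toℚ (proj₂ (sign-f C (CycleBody-full cyc) e) (avoid cyc)))

  cdim-< : {H C* : Sub G} → CycleBody (full G) C* → ∀ {e} → e ∈ˢ es C* → (∀ {C} → CycleBody H C → e ∉ˢ es C) →
           ∀ {d₁ d₂} → CDim H d₁ → CDim (full G) d₂ → d₁ < d₂
  cdim-< {H} cyc* e∈C* avoid (_ , minimal₁) ((f , sign-f , span₂) , _) =
    let (r , span₁) = spanDim-exists H f
    in ≤-<-trans (minimal₁ f r (IsSignLabeling-restrict sign-f) span₁) (spanDim-< sign-f cyc* e∈C* avoid span₁ span₂)

proposition3p1 : (G : Graph) (w : Walk G) → IsPathSegment G w →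
    ∃₂ λ (d₁ d₂ : ℕ) → CDim (minus G (body w)) d₁ × CDim (full G) d₂ × (d₁ < d₂)
proposition3p1 G w (1≤len , (C* , cyc* , _ , w⊆C*) , _) =
  let (d₁ , cdim₁) = cdim-exists G (minus G (body w))
      (d₂ , cdim₂) = cdim-exists G (full G)
  in d₁ , d₂ , cdim₁ , cdim₂ , cdim-< G cyc* (w⊆C* e∈w) (λ cyc → cycle-avoids-removed-edges G cyc e∈w) cdim₁ cdim₂
  where
  e∈w : edg w (fromℕ< 1≤len) ∈ˢ es (body w)
  e∈w = ∈-⋃-singletons⁺ (edg w) (fromℕ< 1≤len)
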